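{- Call two addresses $\alpha,\beta$ orthogonal, written $\alpha\perp\beta$, if there is an address $\gamma$ such that $\alpha$ begins with $\gamma0$ and $\beta$ begins with $\gamma1$, or vice versa. Then the following relations hold in $F$ for all addresses $\alpha,\beta$: $a_\alpha a_\beta=a_\beta a_\alpha$ whenever $\alpha\perp\beta$; $a_{\alpha11\beta}a_\alpha=a_\alpha a_{\alpha1\beta}$, $a_{\alpha10\beta}a_\alpha=a_\alpha a_{\alpha01\beta}$, $a_{\alpha0\beta}a_\alpha=a_\alpha a_{\alpha00\beta}$; and $a_\alpha^2=a_{\alpha1}a_\alpha a_{\alpha0}$.
   Context: Thompson's group $F$: the group of orientation-preserving piecewise-linear homeomorphisms of $[0,1]$ with finitely many breakpoints, all having dyadic rational coordinates, and all slopes integral powers of $2$; the product $fg$ means $f$ followed by $g$, i.e. $(fg)(t)=g(f(t))$. Let $x_0\in F$ be $t\mapsto t/2$ on $[0,\frac12]$, $t\mapsto t-\frac14$ on $[\frac12,\frac34]$, $t\mapsto 2t-1$ on $[\frac34,1]$. An address is a finite word over $\{0,1\}$. For an address $\alpha=e_1\cdots e_k$ let $I_\alpha=[s,s+2^{ -k}]$ with $s=\sum_j e_j2^{ -j}$, and let $a_\alpha\in F$ be the identity outside $I_\alpha$ and $\varphi_\alpha^{ -1}\circ x_0\circ\varphi_\alpha$ on $I_\alpha$, where $\varphi_\alpha:I_\alpha\to[0,1]$ is the increasing affine bijection. -}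

module Defs where

open import Data.Bool using (Bool; true; false; if_then_else_; _∧_)
open import Data.List using (List; []; _∷_; _++_; length)
open import Data.Nat using (ℕ; zero; suc)
open import Data.Integer using (+_)
open import Data.Rational using (ℚ; 0ℚ; 1ℚ; ½; _+_; _-_; _*_; _/_; _≤_; _≤ᵇ_)
open import Data.Product using (∃-syntax; _×_)
open import Data.Sum using (_⊎_)
open import Relation.Binary.PropositionalEquality using (_≡_)

-- Binary digits: false = 0, true = 1.
Address : Set
Address = List Bool

bit : Bool → ℚ
bit false = 0ℚ
bit true  = 1ℚ

two^ : ℕ → ℚ
two^ zero    = 1ℚ
two^ (suc k) = (+ 2 / 1) * two^ k

half^ : ℕ → ℚ
half^ zero    = 1ℚ
half^ (suc k) = ½ * half^ k

-- s = Σ_j e_j 2^{-j}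
start : Address → ℚ
start [] = 0ℚ
start (e ∷ α) = ½ * bit e + ½ * start α

-- I_α = [start α , start α + 2^{-|α|}]
len : Address → ℚ
len α = half^ (length α)

φ : Address → ℚ → ℚ
φ α t = (t - start α) * two^ (length α)

φ⁻¹ : Address → ℚ → ℚ
φ⁻¹ α u = start α + u * len α

-- An element of F is represented by its action on (the rationals of) [0,1].
Map : Set
Map = ℚ → ℚ

x₀ : Map
x₀ t = if t ≤ᵇ ½ then ½ * t
       else if t ≤ᵇ (+ 3 / 4) then t - (+ 1 / 4)
       else (+ 2 / 1) * t - 1ℚ

inI : Address → ℚ → Bool
inI α t = (start α ≤ᵇ t) ∧ (t ≤ᵇ (start α + len α))

a : Address → Map
a α t = if inI α t then φ⁻¹ α (x₀ (φ α t)) else t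

-- product: fg means f followed by g, (fg)(t) = g(f(t))
infixl 7 _·_
_·_ : Map → Map → Map
(f · g) t = g (f t)

infix 4 _≈_
_≈_ : Map → Map → Set
f ≈ g = ∀ (t : ℚ) → 0ℚ ≤ t → t ≤ 1ℚ → f t ≡ g t

prefixOrth : Address → Address → Set
prefixOrth α β = ∃[ γ ] ∃[ δ ] ∃[ ε ] (α ≡ γ ++ false ∷ δ × β ≡ γ ++ true ∷ ε)

_⊥_ : Address → Address → Set
α ⊥ β = prefixOrth α β ⊎ prefixOrth β α

module Submission where

-- Let φ⁻¹ ρ : [0,1] → I_ρ be the affine chart of I_ρ and X₀ the extension of
-- x₀ by the identity outside [0,1].  Two facts drive everything:
--     a_ρ ∘ φ⁻¹ρ = φ⁻¹ρ ∘ X₀    and (locality)    a_{αβ} ∘ φ⁻¹α = φ⁻¹α ∘ a_β.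
-- Each remaining relation is first proved at the root α = ∅, where a_∅ is
-- X₀, by cutting [0,1] into dyadic pieces on which both sides are either
-- compositions of affine moves between the same intervals or locality on
-- both sides; locality then transports it to an arbitrary address α.

open import Defs
open import Data.Bool using (Bool; true; false; T; if_then_else_; _∧_)
open import Data.Bool.Properties using (T-≡; ⇔→≡)
open import Data.List using ([]; _∷_; _++_; length)
open import Data.Nat using (zero; suc)
open import Data.Integer using (+_)
open import Data.Product using (_×_; _,_; proj₁; proj₂)
open import Data.Sum using (_⊎_; inj₁; inj₂; [_,_]′)
open import Data.Unit using (tt)
open import Data.Empty using (⊥-elim)
open import Data.Rational using (ℚ; 0ℚ; 1ℚ; ½; _+_; _-_; _*_; _/_; _≤_; _≤ᵇ_; -_)
open import Data.Rational.Properties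
  using (≤ᵇ⇒≤; ≤⇒≤ᵇ; ≤-antisym; ≤-trans; _≤?_; ≰⇒>; <⇒≤;
         +-monoʳ-≤; *-monoˡ-≤-nonNeg; *-cancelˡ-≤-pos)
open import Data.Rational.Solver using (module +-*-Solver)
open import Function.Bundles using (mk⇔; module Equivalence)
open import Relation.Nullary using (yes; no)
open import Relation.Binary.PropositionalEquality
open +-*-Solver

InUnit : ℚ → Set
InUnit v = 0ℚ ≤ v × v ≤ 1ℚ

Outside : ℚ → Set
Outside v = v ≤ 0ℚ ⊎ 1ℚ ≤ v

0∈unit : InUnit 0ℚ
0∈unit = ≤ᵇ⇒≤ tt , ≤ᵇ⇒≤ tt

1∈unit : InUnit 1ℚ
1∈unit = ≤ᵇ⇒≤ tt , ≤ᵇ⇒≤ tt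

unit-or-outside : ∀ v → InUnit v ⊎ Outside v
unit-or-outside v with 0ℚ ≤? v | v ≤? 1ℚ
... | yes l | yes h = inj₁ (l , h)
... | no l  | _     = inj₂ (inj₁ (<⇒≤ (≰⇒> l)))
... | yes _ | no h  = inj₂ (inj₂ (<⇒≤ (≰⇒> h)))

≤ᵇ-cong : ∀ {p q p′ q′} → (p ≤ q → p′ ≤ q′) → (p′ ≤ q′ → p ≤ q) →
          (p ≤ᵇ q) ≡ (p′ ≤ᵇ q′)
≤ᵇ-cong to from = ⇔→≡ {z = true} (mk⇔
  (λ e → Equivalence.to T-≡ (≤⇒≤ᵇ (to (≤ᵇ⇒≤ (Equivalence.from T-≡ e)))))
  (λ e → Equivalence.to T-≡ (≤⇒≤ᵇ (from (≤ᵇ⇒≤ (Equivalence.from T-≡ e))))))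

halve-mono : ∀ c {x y} → x ≤ y → c + ½ * x ≤ c + ½ * y
halve-mono c le = +-monoʳ-≤ c (*-monoˡ-≤-nonNeg ½ le)

halve-reflect : ∀ c {x y} → c + ½ * x ≤ c + ½ * y → x ≤ y
halve-reflect c {x} {y} le = *-cancelˡ-≤-pos ½
  (subst₂ _≤_ (cancel x) (cancel y) (+-monoʳ-≤ (- c) le))
  where
  cancel : ∀ z → (- c) + (c + ½ * z) ≡ ½ * z
  cancel z = solve 2 (λ c z → (:- c) :+ (c :+ z) := z) refl c (½ * z)

-- φ⁻¹ ρ is the increasing affine bijection [0,1] → I_ρ and φ ρ its inverse;
-- they are inverse because the length of I_ρ is 2^{-|ρ|}.
half^-two^ : ∀ k → half^ k * two^ k ≡ 1ℚ
half^-two^ zero    = refl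
half^-two^ (suc k) = begin
  (½ * half^ k) * ((+ 2 / 1) * two^ k)
    ≡⟨ solve 2 (λ h t → (con ½ :* h) :* (con (+ 2 / 1) :* t)
                      := (con ½ :* con (+ 2 / 1)) :* (h :* t)) refl (half^ k) (two^ k) ⟩
  (½ * (+ 2 / 1)) * (half^ k * two^ k)
    ≡⟨ cong ((½ * (+ 2 / 1)) *_) (half^-two^ k) ⟩
  1ℚ ∎
  where open ≡-Reasoning

φ⁻¹-[] : ∀ u → φ⁻¹ [] u ≡ u
φ⁻¹-[] = solve 1 (λ u → con 0ℚ :+ u :* con 1ℚ := u) refl

φ⁻¹-∷ : ∀ e γ u → φ⁻¹ (e ∷ γ) u ≡ ½ * bit e + ½ * φ⁻¹ γ u
φ⁻¹-∷ e γ u = solve 4 (λ b s h u → (con ½ :* b :+ con ½ :* s) :+ u :* (con ½ :* h)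
                                 := con ½ :* b :+ con ½ :* (s :+ u :* h))
                      refl (bit e) (start γ) (len γ) u

φ⁻¹-++ : ∀ α β u → φ⁻¹ (α ++ β) u ≡ φ⁻¹ α (φ⁻¹ β u)
φ⁻¹-++ []      β u = sym (φ⁻¹-[] (φ⁻¹ β u))
φ⁻¹-++ (e ∷ α) β u = begin
  φ⁻¹ (e ∷ (α ++ β)) u          ≡⟨ φ⁻¹-∷ e (α ++ β) u ⟩
  ½ * bit e + ½ * φ⁻¹ (α ++ β) u ≡⟨ cong (λ z → ½ * bit e + ½ * z) (φ⁻¹-++ α β u) ⟩
  ½ * bit e + ½ * φ⁻¹ α (φ⁻¹ β u) ≡⟨ sym (φ⁻¹-∷ e α (φ⁻¹ β u)) ⟩
  φ⁻¹ (e ∷ α) (φ⁻¹ β u)         ∎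
  where open ≡-Reasoning

φ-φ⁻¹ : ∀ α u → φ α (φ⁻¹ α u) ≡ u
φ-φ⁻¹ α u = begin
  (start α + u * len α - start α) * two^ (length α)
    ≡⟨ solve 4 (λ s u h t → (s :+ u :* h :- s) :* t := u :* (h :* t))
               refl (start α) u (len α) (two^ (length α)) ⟩
  u * (len α * two^ (length α)) ≡⟨ cong (u *_) (half^-two^ (length α)) ⟩
  u * 1ℚ                         ≡⟨ solve 1 (λ u → u :* con 1ℚ := u) refl u ⟩
  u ∎
  where open ≡-Reasoning

φ⁻¹-φ : ∀ α t → φ⁻¹ α (φ α t) ≡ t
φ⁻¹-φ α t = begin
  start α + ((t - start α) * two^ (length α)) * len α
    ≡⟨ solve 4 (λ s t h T → s :+ ((t :- s) :* T) :* h := s :+ (t :- s) :* (h :* T))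
               refl (start α) t (len α) (two^ (length α)) ⟩
  start α + (t - start α) * (len α * two^ (length α))
    ≡⟨ cong (λ z → start α + (t - start α) * z) (half^-two^ (length α)) ⟩
  start α + (t - start α) * 1ℚ
    ≡⟨ solve 2 (λ s t → s :+ (t :- s) :* con 1ℚ := t) refl (start α) t ⟩
  t ∎
  where open ≡-Reasoning

φ⁻¹-mono : ∀ γ {x y} → x ≤ y → φ⁻¹ γ x ≤ φ⁻¹ γ y
φ⁻¹-mono []      {x} {y} le = subst₂ _≤_ (sym (φ⁻¹-[] x)) (sym (φ⁻¹-[] y)) le
φ⁻¹-mono (e ∷ γ) {x} {y} le =
  subst₂ _≤_ (sym (φ⁻¹-∷ e γ x)) (sym (φ⁻¹-∷ e γ y))
             (halve-mono (½ * bit e) (φ⁻¹-mono γ le))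

φ⁻¹-reflect : ∀ γ {x y} → φ⁻¹ γ x ≤ φ⁻¹ γ y → x ≤ y
φ⁻¹-reflect []      {x} {y} le = subst₂ _≤_ (φ⁻¹-[] x) (φ⁻¹-[] y) le
φ⁻¹-reflect (e ∷ γ) {x} {y} le =
  φ⁻¹-reflect γ (halve-reflect (½ * bit e) (subst₂ _≤_ (φ⁻¹-∷ e γ x) (φ⁻¹-∷ e γ y) le))

bit-bounds : ∀ e → 0ℚ ≤ ½ * bit e + ½ * 0ℚ × ½ * bit e + ½ * 1ℚ ≤ 1ℚ
bit-bounds false = ≤ᵇ⇒≤ tt , ≤ᵇ⇒≤ tt
bit-bounds true  = ≤ᵇ⇒≤ tt , ≤ᵇ⇒≤ tt

φ⁻¹-unit : ∀ γ {u} → InUnit u → InUnit (φ⁻¹ γ u)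
φ⁻¹-unit []      {u} i = subst InUnit (sym (φ⁻¹-[] u)) i
φ⁻¹-unit (e ∷ γ) {u} i with φ⁻¹-unit γ i
... | l , h = subst InUnit (sym (φ⁻¹-∷ e γ u))
  ( ≤-trans (proj₁ (bit-bounds e)) (halve-mono (½ * bit e) l)
  , ≤-trans (halve-mono (½ * bit e) h) (proj₂ (bit-bounds e)))

first-half : ∀ ρ {w} → InUnit w → φ⁻¹ (false ∷ ρ) w ≤ ½
first-half ρ {w} i = subst (_≤ ½) (sym (φ⁻¹-∷ false ρ w))
  (≤-trans (halve-mono (½ * 0ℚ) (proj₂ (φ⁻¹-unit ρ i))) (≤ᵇ⇒≤ tt))

second-half : ∀ ρ {w} → InUnit w → ½ ≤ φ⁻¹ (true ∷ ρ) w
second-half ρ {w} i = subst (½ ≤_) (sym (φ⁻¹-∷ true ρ w))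
  (≤-trans (≤ᵇ⇒≤ tt) (halve-mono (½ * 1ℚ) (proj₁ (φ⁻¹-unit ρ i))))

φ-≤ : ∀ δ {t x} → t ≤ φ⁻¹ δ x → φ δ t ≤ x
φ-≤ δ {t} le = φ⁻¹-reflect δ (subst (_≤ _) (sym (φ⁻¹-φ δ t)) le)

≤-φ : ∀ δ {t x} → φ⁻¹ δ x ≤ t → x ≤ φ δ t
≤-φ δ {t} le = φ⁻¹-reflect δ (subst (_ ≤_) (sym (φ⁻¹-φ δ t)) le)

start-φ⁻¹ : ∀ γ → start γ ≡ φ⁻¹ γ 0ℚ
start-φ⁻¹ γ = solve 2 (λ s h → s := s :+ con 0ℚ :* h) refl (start γ) (len γ)

end-φ⁻¹ : ∀ γ → start γ + len γ ≡ φ⁻¹ γ 1ℚ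
end-φ⁻¹ γ = solve 2 (λ s h → s :+ h := s :+ con 1ℚ :* h) refl (start γ) (len γ)

inUnitᵇ : ℚ → Bool
inUnitᵇ v = (0ℚ ≤ᵇ v) ∧ (v ≤ᵇ 1ℚ)

inI-φ⁻¹ : ∀ γ u → inI γ (φ⁻¹ γ u) ≡ inUnitᵇ u
inI-φ⁻¹ γ u = cong₂ _∧_
  (≤ᵇ-cong {start γ} {φ⁻¹ γ u} {0ℚ} {u}
           (λ le → φ⁻¹-reflect γ (subst (_≤ φ⁻¹ γ u) (start-φ⁻¹ γ) le))
           (λ le → subst (_≤ φ⁻¹ γ u) (sym (start-φ⁻¹ γ)) (φ⁻¹-mono γ le)))
  (≤ᵇ-cong {φ⁻¹ γ u} {start γ + len γ} {u} {1ℚ}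
           (λ le → φ⁻¹-reflect γ (subst (φ⁻¹ γ u ≤_) (end-φ⁻¹ γ) le))
           (λ le → subst (φ⁻¹ γ u ≤_) (sym (end-φ⁻¹ γ)) (φ⁻¹-mono γ le)))

-- x₀ extended by the identity outside [0,1]; it plays the role of a_∅.
X₀ : Map
X₀ v = if inUnitᵇ v then x₀ v else v

a-φ⁻¹ : ∀ γ u → a γ (φ⁻¹ γ u) ≡ φ⁻¹ γ (X₀ u)
a-φ⁻¹ γ u = trans (cong₂ (λ b z → if b then φ⁻¹ γ (x₀ z) else φ⁻¹ γ u)
                          (inI-φ⁻¹ γ u) (φ-φ⁻¹ γ u))
                   (φ⁻¹-if (inUnitᵇ u))
  where
  φ⁻¹-if : ∀ b → (if b then φ⁻¹ γ (x₀ u) else φ⁻¹ γ u)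
               ≡ φ⁻¹ γ (if b then x₀ u else u)
  φ⁻¹-if true  = refl
  φ⁻¹-if false = refl

a-chart : ∀ γ t → a γ t ≡ φ⁻¹ γ (X₀ (φ γ t))
a-chart γ t = trans (cong (a γ) (sym (φ⁻¹-φ γ t))) (a-φ⁻¹ γ (φ γ t))

a-++ : ∀ α β u → a (α ++ β) (φ⁻¹ α u) ≡ φ⁻¹ α (a β u)
a-++ α β u = begin
  a (α ++ β) (φ⁻¹ α u)         ≡⟨ cong (λ z → a (α ++ β) (φ⁻¹ α z)) (sym (φ⁻¹-φ β u)) ⟩
  a (α ++ β) (φ⁻¹ α (φ⁻¹ β v)) ≡⟨ cong (a (α ++ β)) (sym (φ⁻¹-++ α β v)) ⟩
  a (α ++ β) (φ⁻¹ (α ++ β) v)  ≡⟨ a-φ⁻¹ (α ++ β) v ⟩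
  φ⁻¹ (α ++ β) (X₀ v)          ≡⟨ φ⁻¹-++ α β (X₀ v) ⟩
  φ⁻¹ α (φ⁻¹ β (X₀ v))         ≡⟨ cong (φ⁻¹ α) (sym (a-φ⁻¹ β v)) ⟩
  φ⁻¹ α (a β (φ⁻¹ β v))        ≡⟨ cong (λ z → φ⁻¹ α (a β z)) (φ⁻¹-φ β u) ⟩
  φ⁻¹ α (a β u)                ∎
  where open ≡-Reasoning
        v : ℚ
        v = φ β u

-- The breakpoints and linear pieces of x₀: t/2 on [0,½], t - ¼ on [½,¾],
-- 2t - 1 on [¾,1] (on the overlaps the definition agrees with both).
q14 q34 : ℚ
q14 = + 1 / 4
q34 = + 3 / 4

x₀-left : ∀ {v} → v ≤ ½ → x₀ v ≡ ½ * v
x₀-left {v} le with v ≤ᵇ ½ in e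
... | true  = refl
... | false = ⊥-elim (subst T e (≤⇒≤ᵇ le))

x₀-middle : ∀ {v} → ½ ≤ v → v ≤ q34 → x₀ v ≡ v - q14
x₀-middle {v} l h with v ≤ᵇ ½ in e
... | true  = let v≡½ = ≤-antisym (≤ᵇ⇒≤ (subst T (sym e) tt)) l
              in trans (cong (½ *_) v≡½) (cong (_- q14) (sym v≡½))
... | false with v ≤ᵇ q34 in e′
...   | true  = refl
...   | false = ⊥-elim (subst T e′ (≤⇒≤ᵇ h))

x₀-right : ∀ {v} → q34 ≤ v → x₀ v ≡ (+ 2 / 1) * v - 1ℚ
x₀-right {v} l with v ≤ᵇ ½ in e
... | true  = ⊥-elim (≤⇒≤ᵇ {q34} {½} (≤-trans l (≤ᵇ⇒≤ (subst T (sym e) tt))))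
... | false with v ≤ᵇ q34 in e′
...   | true  = let v≡¾ = ≤-antisym (≤ᵇ⇒≤ (subst T (sym e′) tt)) l
                in trans (cong (_- q14) v≡¾) (cong (λ z → (+ 2 / 1) * z - 1ℚ) (sym v≡¾))
...   | false = refl

X₀-inside : ∀ {v} → InUnit v → X₀ v ≡ x₀ v
X₀-inside {v} (l , h) with 0ℚ ≤ᵇ v in e | v ≤ᵇ 1ℚ in e′
... | true  | true  = refl
... | false | _     = ⊥-elim (subst T e (≤⇒≤ᵇ l))
... | true  | false = ⊥-elim (subst T e′ (≤⇒≤ᵇ h))

-- Outside (0,1) X₀ is the identity (x₀ fixes the endpoints 0 and 1).
X₀-outside : ∀ v → Outside v → X₀ v ≡ v
X₀-outside v o with 0ℚ ≤ᵇ v in e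
... | false = refl
... | true with v ≤ᵇ 1ℚ in e′
...   | false = refl
...   | true with o
...     | inj₁ le = let v≡0 = ≤-antisym le (≤ᵇ⇒≤ (subst T (sym e) tt))
                    in trans (cong x₀ v≡0) (sym v≡0)
...     | inj₂ le = let v≡1 = ≤-antisym (≤ᵇ⇒≤ (subst T (sym e′) tt)) le
                    in trans (cong x₀ v≡1) (sym v≡1)

record _∈ᴵ_ (t : ℚ) (ρ : Address) : Set where
  constructor at
  field
    coord    : ℚ
    coord∈   : InUnit coord
    is-image : t ≡ φ⁻¹ ρ coord

piece-unit : ∀ {t ρ} → t ∈ᴵ ρ → InUnit t
piece-unit {ρ = ρ} (at w i refl) = φ⁻¹-unit ρ i

between-endpoints : ∀ δ {t} → φ⁻¹ δ 0ℚ ≤ t → t ≤ φ⁻¹ δ 1ℚ → t ∈ᴵ δ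
between-endpoints δ {t} l h = at (φ δ t) (≤-φ δ l , φ-≤ δ h) (sym (φ⁻¹-φ δ t))

halves : ∀ {u} → InUnit u → u ∈ᴵ (false ∷ []) ⊎ u ∈ᴵ (true ∷ [])
halves {u} (l , h) with u ≤? ½
... | yes le = inj₁ (between-endpoints (false ∷ [])
                      (≤-trans (≤ᵇ⇒≤ tt) l) (≤-trans le (≤ᵇ⇒≤ tt)))
... | no  gt = inj₂ (between-endpoints (true ∷ [])
                      (≤-trans (≤ᵇ⇒≤ tt) (<⇒≤ (≰⇒> gt))) (≤-trans h (≤ᵇ⇒≤ tt)))

subdivide : ∀ ρ {t} → t ∈ᴵ ρ → t ∈ᴵ (ρ ++ false ∷ []) ⊎ t ∈ᴵ (ρ ++ true ∷ [])
subdivide ρ (at w i refl) with halves i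
... | inj₁ (at v j refl) = inj₁ (at v j (sym (φ⁻¹-++ ρ (false ∷ []) v)))
... | inj₂ (at v j refl) = inj₂ (at v j (sym (φ⁻¹-++ ρ (true ∷ []) v)))

thirds : ∀ {u} → InUnit u →
         u ∈ᴵ (false ∷ []) ⊎ u ∈ᴵ (true ∷ false ∷ []) ⊎ u ∈ᴵ (true ∷ true ∷ [])
thirds i with halves i
... | inj₁ p = inj₁ p
... | inj₂ p = inj₂ (subdivide (true ∷ []) p)

quarters : ∀ {u} → InUnit u →
           u ∈ᴵ (false ∷ []) ⊎ u ∈ᴵ (true ∷ false ∷ [])
           ⊎ u ∈ᴵ (true ∷ true ∷ false ∷ []) ⊎ u ∈ᴵ (true ∷ true ∷ true ∷ [])
quarters i with thirds i
... | inj₁ p        = inj₁ p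
... | inj₂ (inj₁ p) = inj₂ (inj₁ p)
... | inj₂ (inj₂ p) = inj₂ (inj₂ (subdivide (true ∷ true ∷ []) p))

-- f maps I_ρ onto I_σ by the affine bijection φ⁻¹ σ ∘ φ ρ.
-- (A record, so that the addresses can be inferred from a proof.)
record Moves (f : Map) (ρ σ : Address) : Set where
  constructor moves
  field move : ∀ w → InUnit w → f (φ⁻¹ ρ w) ≡ φ⁻¹ σ w

moves-· : ∀ {f g ρ σ τ} → Moves f ρ σ → Moves g σ τ → Moves (f · g) ρ τ
moves-· {g = g} (moves F) (moves G) = moves λ w i → trans (cong g (F w i)) (G w i)

moves-extend : ∀ {f ρ σ} γ → Moves f ρ σ → Moves f (ρ ++ γ) (σ ++ γ)
moves-extend {f} {ρ} {σ} γ (moves F) = moves λ w i → begin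
  f (φ⁻¹ (ρ ++ γ) w)  ≡⟨ cong f (φ⁻¹-++ ρ γ w) ⟩
  f (φ⁻¹ ρ (φ⁻¹ γ w)) ≡⟨ F (φ⁻¹ γ w) (φ⁻¹-unit γ i) ⟩
  φ⁻¹ σ (φ⁻¹ γ w)     ≡⟨ sym (φ⁻¹-++ σ γ w) ⟩
  φ⁻¹ (σ ++ γ) w      ∎
  where open ≡-Reasoning

moves-under-prefix : ∀ {δ ρ σ} γ → Moves (a δ) ρ σ → Moves (a (γ ++ δ)) (γ ++ ρ) (γ ++ σ)
moves-under-prefix {δ} {ρ} {σ} γ (moves F) = moves λ w i → begin
  a (γ ++ δ) (φ⁻¹ (γ ++ ρ) w)  ≡⟨ cong (a (γ ++ δ)) (φ⁻¹-++ γ ρ w) ⟩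
  a (γ ++ δ) (φ⁻¹ γ (φ⁻¹ ρ w)) ≡⟨ a-++ γ δ (φ⁻¹ ρ w) ⟩
  φ⁻¹ γ (a δ (φ⁻¹ ρ w))        ≡⟨ cong (φ⁻¹ γ) (F w i) ⟩
  φ⁻¹ γ (φ⁻¹ σ w)              ≡⟨ sym (φ⁻¹-++ γ σ w) ⟩
  φ⁻¹ (γ ++ σ) w               ∎
  where open ≡-Reasoning

a-moves : ∀ {ρ σ} δ → Moves X₀ ρ σ → Moves (a δ) (δ ++ ρ) (δ ++ σ)
a-moves {ρ} {σ} δ (moves F) = moves λ w i → begin
  a δ (φ⁻¹ (δ ++ ρ) w)  ≡⟨ cong (a δ) (φ⁻¹-++ δ ρ w) ⟩
  a δ (φ⁻¹ δ (φ⁻¹ ρ w)) ≡⟨ a-φ⁻¹ δ (φ⁻¹ ρ w) ⟩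
  φ⁻¹ δ (X₀ (φ⁻¹ ρ w))  ≡⟨ cong (φ⁻¹ δ) (F w i) ⟩
  φ⁻¹ δ (φ⁻¹ σ w)       ≡⟨ sym (φ⁻¹-++ δ σ w) ⟩
  φ⁻¹ (δ ++ σ) w        ∎
  where open ≡-Reasoning

moves-agree : ∀ {f g ρ σ t} → Moves f ρ σ → Moves g ρ σ → t ∈ᴵ ρ → f t ≡ g t
moves-agree (moves F) (moves G) (at w i refl) = trans (F w i) (sym (G w i))

moves-unit : ∀ {f ρ σ t} → Moves f ρ σ → t ∈ᴵ ρ → InUnit (f t)
moves-unit {σ = σ} (moves F) (at w i refl) = subst InUnit (sym (F w i)) (φ⁻¹-unit σ i)

chart : ∀ {n} → Address → Polynomial n → Polynomial n
chart ρ e = con (start ρ) :+ e :* con (len ρ)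

X₀-moves-0 : Moves X₀ (false ∷ []) (false ∷ false ∷ [])
X₀-moves-0 = moves λ w i → begin
  X₀ (φ⁻¹ (false ∷ []) w) ≡⟨ X₀-inside (φ⁻¹-unit (false ∷ []) i) ⟩
  x₀ (φ⁻¹ (false ∷ []) w) ≡⟨ x₀-left (first-half [] i) ⟩
  ½ * φ⁻¹ (false ∷ []) w  ≡⟨ solve 1 (λ w → con ½ :* chart (false ∷ []) w
                                          := chart (false ∷ false ∷ []) w) refl w ⟩
  φ⁻¹ (false ∷ false ∷ []) w ∎
  where open ≡-Reasoning

X₀-moves-10 : Moves X₀ (true ∷ false ∷ []) (false ∷ true ∷ [])
X₀-moves-10 = moves λ w i → begin
  X₀ (φ⁻¹ ρ w)  ≡⟨ X₀-inside (φ⁻¹-unit ρ i) ⟩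
  x₀ (φ⁻¹ ρ w)  ≡⟨ x₀-middle (second-half (false ∷ []) i)
                             (≤-trans (φ⁻¹-mono ρ (proj₂ i)) (≤ᵇ⇒≤ tt)) ⟩
  φ⁻¹ ρ w - q14 ≡⟨ solve 1 (λ w → chart ρ w :- con q14
                                := chart (false ∷ true ∷ []) w) refl w ⟩
  φ⁻¹ (false ∷ true ∷ []) w ∎
  where open ≡-Reasoning
        ρ : Address
        ρ = true ∷ false ∷ []

X₀-moves-11 : Moves X₀ (true ∷ true ∷ []) (true ∷ [])
X₀-moves-11 = moves λ w i → begin
  X₀ (φ⁻¹ ρ w)                ≡⟨ X₀-inside (φ⁻¹-unit ρ i) ⟩
  x₀ (φ⁻¹ ρ w)                ≡⟨ x₀-right (≤-trans (≤ᵇ⇒≤ tt) (φ⁻¹-mono ρ (proj₁ i))) ⟩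
  (+ 2 / 1) * φ⁻¹ ρ w - 1ℚ    ≡⟨ solve 1 (λ w → con (+ 2 / 1) :* chart ρ w :- con 1ℚ
                                                := chart (true ∷ []) w) refl w ⟩
  φ⁻¹ (true ∷ []) w ∎
  where open ≡-Reasoning
        ρ : Address
        ρ = true ∷ true ∷ []

X₀-unit : ∀ {v} → InUnit v → InUnit (X₀ v)
X₀-unit i = [ moves-unit X₀-moves-0
            , [ moves-unit X₀-moves-10 , moves-unit X₀-moves-11 ]′ ]′ (thirds i)

a-fixes-off-chart : ∀ δ t → Outside (φ δ t) → a δ t ≡ t
a-fixes-off-chart δ t o =
  trans (a-chart δ t) (trans (cong (φ⁻¹ δ) (X₀-outside (φ δ t) o)) (φ⁻¹-φ δ t))

a-support : ∀ δ t → t ∈ᴵ δ ⊎ a δ t ≡ t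
a-support δ t with unit-or-outside (φ δ t)
... | inj₁ i = inj₁ (at (φ δ t) i (sym (φ⁻¹-φ δ t)))
... | inj₂ o = inj₂ (a-fixes-off-chart δ t o)

a-fixes-off : ∀ δ t → t ≤ φ⁻¹ δ 0ℚ ⊎ φ⁻¹ δ 1ℚ ≤ t → a δ t ≡ t
a-fixes-off δ t (inj₁ le) = a-fixes-off-chart δ t (inj₁ (φ-≤ δ le))
a-fixes-off δ t (inj₂ le) = a-fixes-off-chart δ t (inj₂ (≤-φ δ le))

a-preserves-piece : ∀ δ {t} → t ∈ᴵ δ → a δ t ∈ᴵ δ
a-preserves-piece δ (at w i refl) = at (X₀ w) (X₀-unit i) (a-φ⁻¹ δ w)

a-unit : ∀ δ {t} → InUnit t → InUnit (a δ t)
a-unit δ {t} i with a-support δ t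
... | inj₁ p = piece-unit (a-preserves-piece δ p)
... | inj₂ e = subst InUnit (sym e) i

-- Two sibling intervals I_{0ρ} and I_{1δ} meet only at ½, which a_{1δ}
-- (resp. a_{0δ}) fixes.
a-fixes-left-sibling : ∀ ρ δ → Moves (a (true ∷ δ)) (false ∷ ρ) (false ∷ ρ)
a-fixes-left-sibling ρ δ = moves λ w i → a-fixes-off (true ∷ δ) _
  (inj₁ (≤-trans (first-half ρ i) (second-half δ 0∈unit)))

a-fixes-right-sibling : ∀ ρ δ → Moves (a (false ∷ δ)) (true ∷ ρ) (true ∷ ρ)
a-fixes-right-sibling ρ δ = moves λ w i → a-fixes-off (false ∷ δ) _
  (inj₂ (≤-trans (first-half δ 1∈unit) (second-half ρ i)))

a-fixes-orthogonal : ∀ δ {ρ} → ρ ⊥ δ → Moves (a δ) ρ ρ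
a-fixes-orthogonal _ (inj₁ (γ , ρ , δ , refl , refl)) =
  moves-under-prefix γ (a-fixes-left-sibling ρ δ)
a-fixes-orthogonal _ (inj₂ (γ , δ , ρ , refl , refl)) =
  moves-under-prefix γ (a-fixes-right-sibling ρ δ)

siblings : ∀ γ {ρ δ} → (γ ++ false ∷ ρ) ⊥ (γ ++ true ∷ δ)
siblings γ {ρ} {δ} = inj₁ (γ , ρ , δ , refl , refl)

⊥-sym : ∀ {α β} → α ⊥ β → β ⊥ α
⊥-sym (inj₁ o) = inj₂ o
⊥-sym (inj₂ o) = inj₁ o

fixes-piece : ∀ {ρ δ t} → ρ ⊥ δ → t ∈ᴵ ρ → a δ t ≡ t
fixes-piece {δ = δ} o (at w i refl) = Moves.move (a-fixes-orthogonal δ o) w i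

-- Generators at orthogonal addresses commute: each one is supported on its
-- own interval, maps it into itself, and is fixed pointwise by the other.
a-commute : ∀ α β → α ⊥ β → ∀ t → (a α · a β) t ≡ (a β · a α) t
a-commute α β o t with a-support α t
... | inj₁ p = trans (fixes-piece o (a-preserves-piece α p))
                     (cong (a α) (sym (fixes-piece o p)))
... | inj₂ fixα with a-support β t
...   | inj₁ q    = trans (cong (a β) fixα)
                          (sym (fixes-piece (⊥-sym o) (a-preserves-piece β q)))
...   | inj₂ fixβ = trans (cong (a β) fixα)
                          (trans fixβ (sym (trans (cong (a α) fixβ) fixα)))

FixesOutside : Map → Set
FixesOutside f = ∀ u → Outside u → f u ≡ u

·-fixes-outside : ∀ {f g} → FixesOutside f → FixesOutside g → FixesOutside (f · g)
·-fixes-outside {f} {g} F G u o = trans (cong g (F u o)) (G u o)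

-- a_δ fixes the complement of (0,1), since I_δ ⊆ [0,1].
a-fixes-outside : ∀ δ → FixesOutside (a δ)
a-fixes-outside δ u (inj₁ le) =
  a-fixes-off δ u (inj₁ (≤-trans le (proj₁ (φ⁻¹-unit δ 0∈unit))))
a-fixes-outside δ u (inj₂ le) =
  a-fixes-off δ u (inj₂ (≤-trans (proj₂ (φ⁻¹-unit δ 1∈unit)) le))

-- Root form of  a_{αγ} a_α = a_α a_{αγ′}.
RootRelation : Address → Address → Set
RootRelation γ γ′ = ∀ u → (a γ · X₀) u ≡ (X₀ · a γ′) u

agree-from-unit : ∀ {f g} → FixesOutside f → FixesOutside g →
                  (∀ {u} → InUnit u → f u ≡ g u) → ∀ u → f u ≡ g u
agree-from-unit F G inside u with unit-or-outside u
... | inj₁ i = inside i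
... | inj₂ o = trans (F u o) (sym (G u o))

-- Both sides of a root relation fix the complement of (0,1).
root-relation : ∀ γ γ′ → (∀ {u} → InUnit u → (a γ · X₀) u ≡ (X₀ · a γ′) u) →
                RootRelation γ γ′
root-relation γ γ′ = agree-from-unit {a γ · X₀} {X₀ · a γ′}
  (·-fixes-outside (a-fixes-outside γ) X₀-outside)
  (·-fixes-outside X₀-outside (a-fixes-outside γ′))

-- On a piece I_ρ that X₀ moves onto I_σ, the relation a_{ρβ} X₀ = X₀ a_{σβ}
-- is locality on both sides.
conjugate-piece : ∀ {ρ σ t} β → Moves X₀ ρ σ → t ∈ᴵ ρ →
                  (a (ρ ++ β) · X₀) t ≡ (X₀ · a (σ ++ β)) t
conjugate-piece {ρ} {σ} β (moves F) (at w i refl) = begin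
  X₀ (a (ρ ++ β) (φ⁻¹ ρ w)) ≡⟨ cong X₀ (a-++ ρ β w) ⟩
  X₀ (φ⁻¹ ρ (a β w))        ≡⟨ F (a β w) (a-unit β i) ⟩
  φ⁻¹ σ (a β w)             ≡⟨ sym (a-++ σ β w) ⟩
  a (σ ++ β) (φ⁻¹ σ w)      ≡⟨ cong (a (σ ++ β)) (sym (F w i)) ⟩
  a (σ ++ β) (X₀ (φ⁻¹ ρ w)) ∎
  where open ≡-Reasoning

root-piece : ∀ γ γ′ {ρ τ τ′ σ t} → Moves (a γ) ρ τ → Moves X₀ τ σ →
             Moves X₀ ρ τ′ → Moves (a γ′) τ′ σ → t ∈ᴵ ρ →
             (a γ · X₀) t ≡ (X₀ · a γ′) t
root-piece γ γ′ A B C D = moves-agree (moves-· A B) (moves-· C D)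

-- The three relations, checked on the pieces I_0, I_10, I_11; all the
-- fixed intervals are orthogonal to the generator fixing them.
root-11 : ∀ β → RootRelation (true ∷ true ∷ β) (true ∷ β)
root-11 β = root-relation γ γ′ λ i →
  [ root-piece γ γ′ (a-fixes-orthogonal γ (siblings [])) X₀-moves-0
                    X₀-moves-0 (a-fixes-orthogonal γ′ (siblings []))
  , [ root-piece γ γ′ (a-fixes-orthogonal γ (siblings (true ∷ []))) X₀-moves-10
                      X₀-moves-10 (a-fixes-orthogonal γ′ (siblings []))
    , conjugate-piece β X₀-moves-11 ]′ ]′ (thirds i)
  where γ γ′ : Address
        γ  = true ∷ true ∷ β
        γ′ = true ∷ β

root-10 : ∀ β → RootRelation (true ∷ false ∷ β) (false ∷ true ∷ β)
root-10 β = root-relation γ γ′ λ i →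
  [ root-piece γ γ′ (a-fixes-orthogonal γ (siblings [])) X₀-moves-0
                    X₀-moves-0 (a-fixes-orthogonal γ′ (siblings (false ∷ [])))
  , [ conjugate-piece β X₀-moves-10
    , root-piece γ γ′ (a-fixes-orthogonal γ (⊥-sym (siblings (true ∷ [])))) X₀-moves-11
                      X₀-moves-11 (a-fixes-orthogonal γ′ (⊥-sym (siblings []))) ]′ ]′
  (thirds i)
  where γ γ′ : Address
        γ  = true ∷ false ∷ β
        γ′ = false ∷ true ∷ β

root-0 : ∀ β → RootRelation (false ∷ β) (false ∷ false ∷ β)
root-0 β = root-relation γ γ′ λ i →
  [ conjugate-piece β X₀-moves-0
  , [ root-piece γ γ′ (a-fixes-orthogonal γ (⊥-sym (siblings []))) X₀-moves-10
                      X₀-moves-10 (a-fixes-orthogonal γ′ (⊥-sym (siblings (false ∷ []))))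
    , root-piece γ γ′ (a-fixes-orthogonal γ (⊥-sym (siblings []))) X₀-moves-11
                      X₀-moves-11 (a-fixes-orthogonal γ′ (⊥-sym (siblings []))) ]′ ]′
  (thirds i)
  where γ γ′ : Address
        γ  = false ∷ β
        γ′ = false ∷ false ∷ β

-- Root form of  a_α² = a_{α1} a_α a_{α0}:  on a piece I_ρ both sides are
-- compositions of moves ending at the same interval.
square-piece : ∀ {ρ τ σ τ₁ τ₂ t} → Moves X₀ ρ τ → Moves X₀ τ σ →
               Moves (a (true ∷ [])) ρ τ₁ → Moves X₀ τ₁ τ₂ → Moves (a (false ∷ [])) τ₂ σ →
               t ∈ᴵ ρ → (X₀ · X₀) t ≡ (a (true ∷ []) · X₀ · a (false ∷ [])) t
square-piece A B C D E = moves-agree (moves-· A B) (moves-· (moves-· C D) E)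

root-square : ∀ u → (X₀ · X₀) u ≡ (a (true ∷ []) · X₀ · a (false ∷ [])) u
root-square = agree-from-unit {X₀ · X₀} {a a1 · X₀ · a a0}
  (·-fixes-outside X₀-outside X₀-outside)
  (·-fixes-outside {a a1 · X₀} (·-fixes-outside {a a1} (a-fixes-outside a1) X₀-outside)
                   (a-fixes-outside a0))
  λ i →
  [ square-piece X₀-moves-0 (moves-extend a0 X₀-moves-0)
                 (a-fixes-orthogonal a1 (siblings [])) X₀-moves-0 (a-moves a0 X₀-moves-0)
  , [ square-piece X₀-moves-10 (moves-extend a1 X₀-moves-0)
                   (a-moves a1 X₀-moves-0) (moves-extend a0 X₀-moves-10)
                   (a-moves a0 X₀-moves-10)
    , [ square-piece (moves-extend a0 X₀-moves-11) X₀-moves-10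
                     (a-moves a1 X₀-moves-10) (moves-extend a1 X₀-moves-10)
                     (a-moves a0 X₀-moves-11)
      , square-piece (moves-extend a1 X₀-moves-11) X₀-moves-11
                     (a-moves a1 X₀-moves-11) X₀-moves-11
                     (a-fixes-orthogonal a0 (⊥-sym (siblings []))) ]′ ]′ ]′ (quarters i)
  where a0 a1 : Address
        a0 = false ∷ []
        a1 = true ∷ []

-- f acts on I_α as g acts on [0,1], read through the chart of α.
-- (A record, so that the maps can be inferred from a proof.)
record Intertwines (α : Address) (f g : Map) : Set where
  constructor intertwines
  field commutes : ∀ u → f (φ⁻¹ α u) ≡ φ⁻¹ α (g u)

intertwines-· : ∀ {α f g f′ g′} → Intertwines α f g → Intertwines α f′ g′ →
                Intertwines α (f · f′) (g · g′)
intertwines-· {g = g} {f′ = f′} (intertwines F) (intertwines G) =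
  intertwines λ u → trans (cong f′ (F u)) (G (g u))

conjugate : ∀ α → Intertwines α (a α) X₀
conjugate α = intertwines (a-φ⁻¹ α)

local : ∀ α β → Intertwines α (a (α ++ β)) (a β)
local α β = intertwines (a-++ α β)

-- Maps acting on I_α as two equal maps act on [0,1] are equal
-- (every t is φ⁻¹ α u for u = φ α t).
transfer : ∀ α {f g f′ g′} → Intertwines α f g → Intertwines α f′ g′ →
           (∀ u → g u ≡ g′ u) → f ≈ f′
transfer α {f} {g} {f′} {g′} (intertwines F) (intertwines F′) g≡g′ t _ _ = begin
  f t                   ≡⟨ cong f (sym (φ⁻¹-φ α t)) ⟩
  f (φ⁻¹ α (φ α t))     ≡⟨ F (φ α t) ⟩
  φ⁻¹ α (g (φ α t))     ≡⟨ cong (φ⁻¹ α) (g≡g′ (φ α t)) ⟩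
  φ⁻¹ α (g′ (φ α t))    ≡⟨ sym (F′ (φ α t)) ⟩
  f′ (φ⁻¹ α (φ α t))    ≡⟨ cong f′ (φ⁻¹-φ α t) ⟩
  f′ t                  ∎
  where open ≡-Reasoning

lift-relation : ∀ α {γ γ′} → RootRelation γ γ′ → a (α ++ γ) · a α ≈ a α · a (α ++ γ′)
lift-relation α {γ} {γ′} = transfer α (intertwines-· (local α γ) (conjugate α))
                                      (intertwines-· (conjugate α) (local α γ′))

lemma2p7 : (∀ α β → α ⊥ β → a α · a β ≈ a β · a α)
    × (∀ α β → a (α ++ true ∷ true ∷ β) · a α ≈ a α · a (α ++ true ∷ β))
    × (∀ α β → a (α ++ true ∷ false ∷ β) · a α ≈ a α · a (α ++ false ∷ true ∷ β))
    × (∀ α β → a (α ++ false ∷ β) · a α ≈ a α · a (α ++ false ∷ false ∷ β))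
    × (∀ α → a α · a α ≈ a (α ++ true ∷ []) · a α · a (α ++ false ∷ []))
lemma2p7 =
    (λ α β o t _ _ → a-commute α β o t)
  , (λ α β → lift-relation α (root-11 β))
  , (λ α β → lift-relation α (root-10 β))
  , (λ α β → lift-relation α (root-0 β))
  , λ α → transfer α
      (intertwines-· (conjugate α) (conjugate α))
      (intertwines-· (intertwines-· (local α (true ∷ [])) (conjugate α))
                     (local α (false ∷ [])))
      root-square
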